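{- Let $G$ be a digraph and $\bar s,\bar t$ tuples of vertices of $G$ such that there is no separation $(A,B)$ of order $1$ in $G$ with all entries of $\bar s,\bar t$ in $A$ and $B\setminus A\neq\emptyset$. For $i=1,2$ let $S_i=(A_i,B_i)$ be separations of order $2$ in $G$ and let $W_i$ be cylindrical walls of order at least $4$ in $G$, such that all entries of $\bar s,\bar t$ lie in $A_1\cap A_2$ and $B_i$ contains the majority of $W_i$ for $i=1,2$. Furthermore, assume at least one of $S_1,S_2$ separates the majority of $W_1$ from the majority of $W_2$. Then either there is a separation $(A,B)$ of order $2$ with all entries of $\bar s,\bar t$ in $A$ and $(B_1\setminus A_1)\cup(B_2\setminus A_2)\subseteq B$, or there are separations $S_i'=(A_i',B_i')$ of order $2$, for $i=1,2$, such that for $i=1,2$ all entries of $\bar s,\bar t$ lie in $A_i'$, $B_i'$ contains the majority of $W_i$, and $(B_1'\setminus A_1')\cap(B_2'\setminus A_2')=\emptyset$. Furthermore, $S_1'=S_1$ or $S_2'=S_2$.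
   Context: A (directed) separation in a digraph $G$ is a pair $(A,B)$ of sets with $A\cup B=V(G)$ such that either no edge has tail in $A\setminus B$ and head in $B\setminus A$, or no edge has tail in $B\setminus A$ and head in $A\setminus B$. Its order is $|A\cap B|$. An elementary cylindrical grid of order $k$ consists of $k$ pairwise disjoint directed cycles $C_1,\dots,C_k$ of length $2k$ together with $2k$ pairwise disjoint directed paths $H_1,\dots,H_{2k}$ of length $k-1$ such that each $H_i$ has exactly one vertex in common with each $C_j$ and has one end in $C_1$ and the other in $C_k$, the paths $H_1,\dots,H_{2k}$ appear on each $C_j$ in this order, and for odd $i$ the cycles $C_1,\dots,C_k$ occur on $H_i$ in this order while for even $i$ they occur in the order $C_k,\dots,C_1$. The elementary cylindrical wall of order $k$ is obtained by replacing each degree-$4$ vertex $v$ of this grid by two new vertices $v_s,v_t$ and an edge $(v_s,v_t)$, where $v_s$ gets the in-neighbours and $v_t$ the out-neighbours of $v$. A cylindrical wall of order $k$ is a subdivision of the elementary cylindrical wall of order $k$; its cycles are the (subdivided) images of $C_1,\dots,C_k$. If $(A,B)$ is a separation of order less than $k$ and $W$ is a cylindrical wall of order $k$, exactly one side $X\in\{A,B\}$ contains (the vertex set of) one of the cycles of $W$; one says that $X$ contains the majority of $W$. A separation $S$ separates the majority of $W_1$ from the majority of $W_2$ if the majorities of $W_1$ and $W_2$ are contained in different sides of $S$. -}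

module Defs where

open import Data.Nat using (ℕ; zero; suc; _+_; _*_; _%_; _<_)
open import Data.Nat.DivMod using (m%n<n)
open import Data.Bool using (Bool; true; false; if_then_else_)
open import Data.Fin using (Fin; zero; suc; toℕ; fromℕ<; inject₁)
open import Data.Fin.Subset using (Subset; _∈_; _∉_; _∩_; _∪_; _─_; ∣_∣; _⊆_)
open import Data.Maybe using (Maybe; just; nothing)
import Data.Maybe as Maybe
open import Data.List using (List; []; _∷_; _++_; _∷ʳ_)
open import Data.List.Relation.Unary.All using (All)
open import Data.List.Relation.Unary.Linked using (Linked)
open import Data.List.Relation.Unary.Unique.Propositional using (Unique)
import Data.List.Membership.Propositional as L
open import Data.Product using (Σ; ∃; ∃-syntax; _×_; _,_)
open import Data.Sum using (_⊎_)
open import Data.Empty using (⊥)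
open import Relation.Binary.PropositionalEquality using (_≡_; _≢_)

-- Digraphs: vertex set Fin n, edge relation E (tail, head).

record Digraph : Set₁ where
  field
    n : ℕ
    E : Fin n → Fin n → Set

open Digraph public

V : Digraph → Set
V G = Fin (n G)

VSet : Digraph → Set
VSet G = Subset (n G)

NoEdgeFromTo : (G : Digraph) → VSet G → VSet G → Set
NoEdgeFromTo G X Y = ∀ u v → E G u v → u ∈ (X ─ Y) → v ∈ (Y ─ X) → ⊥

IsSeparation : (G : Digraph) → VSet G → VSet G → Set
IsSeparation G A B =
  (∀ v → v ∈ A ⊎ v ∈ B) × (NoEdgeFromTo G A B ⊎ NoEdgeFromTo G B A)

order : {G : Digraph} → VSet G → VSet G → ℕ
order A B = ∣ A ∩ B ∣

record Path (G : Digraph) (u v : V G) : Set where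
  field
    inner  : List (V G)
    linked : Linked (E G) (u ∷ inner ∷ʳ v)
    unique : Unique (u ∷ inner ∷ʳ v)

  verts : List (V G)
  verts = u ∷ inner ∷ʳ v

open Path public

-- The elementary cylindrical wall of order k = m + 2.
-- Columns (paths H) indexed by Fin (2k) (0-based), rows (cycles C) by
-- Fin k (0-based).  Grid vertex (i , j) on row 0 or row k-1 has degree 3
-- and stays one vertex ('end i false' / 'end i true'); a grid vertex on an
-- inner row (index 1 + l, l : Fin m) has degree 4 and is split into
-- 'sv i l' (receives in-neighbours) and 'tv i l' (sends out-neighbours).

module Wall (m : ℕ) where

  k : ℕ
  k = suc (suc m)

  Col : Set
  Col = Fin (2 * k)

  Row : Set
  Row = Fin k

  data WV : Set where
    end : Col → Bool → WV
    sv  : Col → Fin m → WV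
    tv  : Col → Fin m → WV

  notLast : ∀ {p} → Fin (suc p) → Maybe (Fin p)
  notLast {zero}  zero    = nothing
  notLast {suc p} zero    = just zero
  notLast {suc p} (suc j) = Maybe.map suc (notLast j)

  inV : Col → Row → WV
  inV i zero = end i false
  inV i (suc j) with notLast j
  ... | nothing = end i true
  ... | just l  = sv i l

  outV : Col → Row → WV
  outV i zero = end i false
  outV i (suc j) with notLast j
  ... | nothing = end i true
  ... | just l  = tv i l

  midRow : Fin m → Row
  midRow l = suc (inject₁ l)

  nextCol : Col → Col
  nextCol i = fromℕ< (m%n<n (suc (toℕ i)) (2 * k))

  isEven : ℕ → Bool
  isEven zero = true
  isEven (suc zero) = false
  isEven (suc (suc x)) = isEven x

  data WE : Set where
    split : Col → Fin m → WE
    cyc   : Col → Row → WE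
    col   : Col → Fin (suc m) → WE

  tailE : WE → WV
  tailE (split i l) = sv i l
  tailE (cyc i j)   = outV i j
  tailE (col i j)   = if isEven (toℕ i) then outV i (inject₁ j) else outV i (suc j)

  headE : WE → WV
  headE (split i l) = tv i l
  headE (cyc i j)   = inV (nextCol i) j
  headE (col i j)   = if isEven (toℕ i) then inV i (suc j) else inV i (inject₁ j)

  OnCycle : Row → WE → Set
  OnCycle j (split i l) = midRow l ≡ j
  OnCycle j (cyc i j')  = j' ≡ j
  OnCycle j (col i j')  = ⊥

-- A cylindrical wall of order m + 2 in G: a subdivision of the elementary
-- cylindrical wall of order m + 2 that is a subgraph of G.

record CylWall (G : Digraph) (m : ℕ) : Set where
  open Wall m
  field
    φ      : WV → V G
    φ-inj  : ∀ x y → φ x ≡ φ y → x ≡ y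
    path   : (e : WE) → Path G (φ (tailE e)) (φ (headE e))
    inner-branch : ∀ e x → φ x L.∈ inner (path e) → ⊥
    inner-disj   : ∀ e e' v → e ≢ e' → v L.∈ inner (path e) → v L.∈ inner (path e') → ⊥

  OnWallCycle : Row → V G → Set
  OnWallCycle j v = ∃[ e ] (OnCycle j e × v L.∈ verts (path e))

-- X contains the majority of W: X contains (the vertex set of) one of the
-- cycles of W.
ContainsMajority : {G : Digraph} {m : ℕ} → VSet G → CylWall G m → Set
ContainsMajority {G} {m} X W =
  ∃[ j ] (∀ v → CylWall.OnWallCycle W j v → v ∈ X)

SeparatesMajorities : {G : Digraph} {m₁ m₂ : ℕ} → VSet G → VSet G →
                      CylWall G m₁ → CylWall G m₂ → Set
SeparatesMajorities A B W₁ W₂ =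
  (ContainsMajority A W₁ × ContainsMajority B W₂) ⊎
  (ContainsMajority B W₁ × ContainsMajority A W₂)

AllIn : {G : Digraph} → List (V G) → VSet G → Set
AllIn xs X = All (λ x → x ∈ X) xs

-- If S₁ and S₂ point the same way, their join (A₁ ∪ A₂, B₁ ∩ B₂)
-- and meet (A₁ ∩ A₂, B₁ ∪ B₂) are separations whose orders add up to at most 4
-- by submodularity.  A separation of order ≤ 1 with s̄t̄ on its small side is
-- trivial, so either the join is trivial and B₁ ∖ A₁, B₂ ∖ A₂ are disjoint, or
-- the meet is trivial and B₁ ⊆ A₁, or the meet has order 2 and is the
-- separation sought.
-- If S₁ and S₂ point opposite ways, the same applies to the crossed separations
-- (A₁ ∪ B₂, B₁ ∩ A₂) and (A₂ ∪ B₁, B₂ ∩ A₁).  When both have order 2, some A_i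
-- holds the majority of the other wall W_j; by a counting argument on four
-- disjoint cycles of W_j, so does B_j ∩ A_i, and the crossed separation
-- (A_j ∪ B_i, B_j ∩ A_i) replaces S_j.

module Submission where

open import Defs
open import Data.Bool using (Bool; true; false; _∧_; _∨_)
open import Data.Empty using (⊥; ⊥-elim)
open import Data.Fin using (Fin; zero; suc; toℕ; fromℕ; fromℕ<; inject₁; _≟_; #_)
open import Data.Fin.Properties using (toℕ-injective; toℕ-inject₁; toℕ-fromℕ<; fromℕ<-toℕ; toℕ<n; any?; all?)
open import Data.Fin.Subset using (Subset; _∈_; _∉_; _∩_; _∪_; _─_; _-_; _⊆_; Empty; ∣_∣; ⁅_⁆)
open import Data.Fin.Subset.Properties
  using (_∈?_; x∈p∩q⁺; x∈p∪q⁻; p∩q⊆p; p∩q⊆q; p⊆p∪q; q⊆p∪q; p─q⊆p; x∈p∧x∉q⇒x∈p─q;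
         x∈p⇒∣p-x∣<∣p∣; x∈p∧x≢y⇒x∈p-y; x∈⁅y⁆⇒x≡y; ⊆-antisym; ∣⁅x⁆∣≡1; ∩-comm; ∪-comm)
open import Data.Maybe using (just; nothing)
open import Data.List using (List; []; _∷_; _++_; _∷ʳ_)
import Data.List.Membership.Propositional as L
open import Data.List.Membership.Propositional.Properties using (∈-++⁻)
open import Data.List.Relation.Unary.Any using (here; there)
open import Data.List.Relation.Unary.Linked using (Linked; _∷_)
open import Data.List.Relation.Unary.All as All using (All)
open import Data.Nat using (ℕ; zero; suc; _+_; _*_; _∸_; _%_; _≤_; _<_; z≤n; s≤s; _≤?_)
open import Data.Nat.DivMod using (m<n⇒m%n≡m; n%n≡0)
open import Data.Nat.Properties
  using (≤-trans; ≤-antisym; ≤-reflexive; ≰⇒>; ≤⇒≯; n≮0; +-comm; +-cancelˡ-≤; +-monoˡ-≤; +-mono-≤;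
         +-commutativeSemigroup; suc-injective;
         m≤n+m; +-suc; n≤1+n; m∸n+n≡m; m≤n⇒∃[o]m+o≡n; <-cmp; <-≤-trans)
open import Algebra.Properties.CommutativeSemigroup +-commutativeSemigroup using (interchange)
open import Data.Product using (_×_; _,_; ∃-syntax; proj₁; proj₂; uncurry; swap)
open import Data.Sum using (_⊎_; inj₁; inj₂; [_,_]′)
import Data.Sum as Sum
import Data.Vec.Base as Vec
open import Function using (_∘_)
open import Relation.Nullary using (¬_; Dec; yes; no)
open import Relation.Nullary.Decidable using (map′; _×-dec_; _→-dec_; decidable-stable)
open import Relation.Binary.Definitions using (Tri; tri<; tri≈; tri>)
open import Relation.Binary.PropositionalEquality using (_≡_; _≢_; refl; sym; trans; cong; cong₂; subst; subst₂)

m+n≤4⇒n≡2 : ∀ {m n} → m + n ≤ 4 → ¬ m ≤ 1 → ¬ n ≤ 1 → n ≡ 2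
m+n≤4⇒n≡2 {m} {n} m+n≤4 m≰1 n≰1 =
  ≤-antisym (+-cancelˡ-≤ 2 n 2 (≤-trans (+-monoˡ-≤ n (≰⇒> m≰1)) m+n≤4)) (≰⇒> n≰1)

m<n⇒n≡1+o+m : ∀ {m n} → m < n → ∃[ o ] (n ≡ suc (o + m))
m<n⇒n≡1+o+m {m} m<n with m≤n⇒∃[o]m+o≡n m<n
... | o , 1+m+o≡n = o , trans (sym 1+m+o≡n) (cong suc (+-comm m o))

module _ {n : ℕ} {p q : Subset n} {x : Fin n} where

  ∈-∩⁺ : x ∈ p → x ∈ q → x ∈ p ∩ q
  ∈-∩⁺ x∈p x∈q = x∈p∩q⁺ (x∈p , x∈q)

  ∈-∩ˡ : x ∈ p ∩ q → x ∈ p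
  ∈-∩ˡ = p∩q⊆p p q

  ∈-∩ʳ : x ∈ p ∩ q → x ∈ q
  ∈-∩ʳ = p∩q⊆q p q

  ∈-∪ˡ : x ∈ p → x ∈ p ∪ q
  ∈-∪ˡ = p⊆p∪q q

  ∈-∪ʳ : x ∈ q → x ∈ p ∪ q
  ∈-∪ʳ = q⊆p∪q p q

  ∈-∪⁻ : x ∈ p ∪ q → x ∈ p ⊎ x ∈ q
  ∈-∪⁻ = x∈p∪q⁻ p q

  ∈-─⁺ : x ∈ p → x ∉ q → x ∈ p ─ q
  ∈-─⁺ = x∈p∧x∉q⇒x∈p─q

  ∈-─ˡ : x ∈ p ─ q → x ∈ p
  ∈-─ˡ = p─q⊆p p q

x∈p─q⇒x∉q : ∀ {n} (p q : Subset n) {x} → x ∈ p ─ q → x ∉ q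
x∈p─q⇒x∉q (_ Vec.∷ p) (true Vec.∷ q) () Vec.here
x∈p─q⇒x∉q (_ Vec.∷ p) (_ Vec.∷ q) (Vec.there x∈p─q) (Vec.there x∈q) = x∈p─q⇒x∉q p q x∈p─q x∈q

∈-─ʳ : ∀ {n} {p q : Subset n} {x} → x ∈ p ─ q → x ∉ q
∈-─ʳ {p = p} {q} = x∈p─q⇒x∉q p q

∣p∣≡0⇒x∉p : ∀ {n} {p : Subset n} {x} → ∣ p ∣ ≡ 0 → x ∉ p
∣p∣≡0⇒x∉p {p = p} {x} ∣p∣≡0 x∈p = n≮0 (subst (∣ p - x ∣ <_) ∣p∣≡0 (x∈p⇒∣p-x∣<∣p∣ x∈p))

∣p∣≤2⇒¬3-distinct : ∀ {n} {p : Subset n} {x y z} → ∣ p ∣ ≤ 2 →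
                    x ∈ p → y ∈ p → z ∈ p → x ≢ y → x ≢ z → y ≢ z → ⊥
∣p∣≤2⇒¬3-distinct {p = p} {x} {y} {z} ∣p∣≤2 x∈p y∈p z∈p x≢y x≢z y≢z = ≤⇒≯ ∣p∣≤2 3≤∣p∣
  where
  y∈p-x : y ∈ p - x
  y∈p-x = x∈p∧x≢y⇒x∈p-y y∈p (x≢y ∘ sym)
  z∈p-x-y : z ∈ p - x - y
  z∈p-x-y = x∈p∧x≢y⇒x∈p-y (x∈p∧x≢y⇒x∈p-y z∈p (x≢z ∘ sym)) (y≢z ∘ sym)
  3≤∣p∣ : 3 ≤ ∣ p ∣
  3≤∣p∣ = ≤-trans (s≤s (≤-trans (s≤s (≤-trans (s≤s z≤n) (x∈p⇒∣p-x∣<∣p∣ z∈p-x-y)))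
                                (x∈p⇒∣p-x∣<∣p∣ y∈p-x)))
                  (x∈p⇒∣p-x∣<∣p∣ x∈p)

Avoids : ∀ {n} {I : Set} → (I → Fin n → Set) → Subset n → I → Set
Avoids F p i = ∀ v → F i v → v ∉ p

-- Stated with ¬ Avoids rather than "meets" so that it also applies where a
-- meeting vertex is only known to exist classically.
∣p∣≤2⇒¬meets-3-disjoint : ∀ {n} {I : Set} {F : I → Fin n → Set} {p : Subset n} {i j k : I} →
  (∀ {i j v} → F i v → F j v → i ≡ j) → ∣ p ∣ ≤ 2 → i ≢ j → i ≢ k → j ≢ k →
  ¬ Avoids F p i → ¬ Avoids F p j → ¬ Avoids F p k → ⊥
∣p∣≤2⇒¬meets-3-disjoint {F = F} disjoint ∣p∣≤2 i≢j i≢k j≢k meets-i meets-j meets-k =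
  meets-i λ u Fu u∈p → meets-j λ v Fv v∈p → meets-k λ w Fw w∈p →
    ∣p∣≤2⇒¬3-distinct ∣p∣≤2 u∈p v∈p w∈p (apart i≢j Fu Fv) (apart i≢k Fu Fw) (apart j≢k Fv Fw)
  where
  apart : ∀ {i j x y} → i ≢ j → F i x → F j y → x ≢ y
  apart i≢j Fx Fy refl = i≢j (disjoint Fx Fy)

bit : Bool → ℕ
bit true  = 1
bit false = 0

∣∷∣+∣∷∣ : ∀ {n} x (p : Subset n) y (q : Subset n) →
          ∣ x Vec.∷ p ∣ + ∣ y Vec.∷ q ∣ ≡ (bit x + bit y) + (∣ p ∣ + ∣ q ∣)
∣∷∣+∣∷∣ x p y q = trans (cong₂ _+_ (∣∷∣ x p) (∣∷∣ y q)) (interchange (bit x) (∣ p ∣) (bit y) (∣ q ∣))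
  where
  ∣∷∣ : ∀ {n} x (p : Subset n) → ∣ x Vec.∷ p ∣ ≡ bit x + ∣ p ∣
  ∣∷∣ true  p = refl
  ∣∷∣ false p = refl

bit-submodular : ∀ x y z w → bit ((x ∨ z) ∧ (y ∧ w)) + bit ((x ∧ z) ∧ (y ∨ w)) ≤ bit (x ∧ y) + bit (z ∧ w)
bit-submodular false _     false _     = z≤n
bit-submodular false false true  _     = z≤n
bit-submodular false true  true  false = z≤n
bit-submodular false true  true  true  = s≤s z≤n
bit-submodular true  false false _     = z≤n
bit-submodular true  true  false false = z≤n
bit-submodular true  true  false true  = s≤s z≤n
bit-submodular true  false true  false = z≤n
bit-submodular true  false true  true  = s≤s z≤n
bit-submodular true  true  true  false = s≤s z≤n
bit-submodular true  true  true  true  = s≤s (s≤s z≤n)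

∣∪∩∣+∣∩∪∣≤∣∩∣+∣∩∣ : ∀ {n} (a b c d : Subset n) →
                    ∣ (a ∪ c) ∩ (b ∩ d) ∣ + ∣ (a ∩ c) ∩ (b ∪ d) ∣ ≤ ∣ a ∩ b ∣ + ∣ c ∩ d ∣
∣∪∩∣+∣∩∪∣≤∣∩∣+∣∩∣ Vec.[] Vec.[] Vec.[] Vec.[] = z≤n
∣∪∩∣+∣∩∪∣≤∣∩∣+∣∩∣ (x Vec.∷ a) (y Vec.∷ b) (z Vec.∷ c) (w Vec.∷ d) =
  subst₂ _≤_ (sym (∣∷∣+∣∷∣ ((x ∨ z) ∧ (y ∧ w)) ((a ∪ c) ∩ (b ∩ d)) ((x ∧ z) ∧ (y ∨ w)) ((a ∩ c) ∩ (b ∪ d))))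
             (sym (∣∷∣+∣∷∣ (x ∧ y) (a ∩ b) (z ∧ w) (c ∩ d)))
             (+-mono-≤ (bit-submodular x y z w) (∣∪∩∣+∣∩∪∣≤∣∩∣+∣∩∣ a b c d))

Covers : ∀ {n} → Subset n → Subset n → Set
Covers A B = ∀ v → v ∈ A ⊎ v ∈ B

Covers-swap : ∀ {n} {A B : Subset n} → Covers A B → Covers B A
Covers-swap cover v = Sum.swap (cover v)

IsSeparation-swap : ∀ {G} {A B : VSet G} → IsSeparation G A B → IsSeparation G B A
IsSeparation-swap (cover , noEdge) = Covers-swap cover , Sum.swap noEdge

∣∩∣-comm : ∀ {n} (A B : Subset n) → ∣ A ∩ B ∣ ≡ ∣ B ∩ A ∣
∣∩∣-comm A B = cong ∣_∣ (∩-comm A B)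

reverse : Digraph → Digraph
reverse G = record { n = n G ; E = λ u v → E G v u }

NoEdgeFromTo-reverse : ∀ {G} {A B : VSet G} → NoEdgeFromTo G A B → NoEdgeFromTo (reverse G) B A
NoEdgeFromTo-reverse noEdge u v e u∈ v∈ = noEdge v u e v∈ u∈

Covers-∪∩ : ∀ {n} {A B A' B' : Subset n} → Covers A B → Covers A' B' → Covers (A ∪ A') (B ∩ B')
Covers-∪∩ cover cover' v with cover v | cover' v
... | inj₁ v∈A | _         = inj₁ (∈-∪ˡ v∈A)
... | inj₂ _   | inj₁ v∈A' = inj₁ (∈-∪ʳ v∈A')
... | inj₂ v∈B | inj₂ v∈B' = inj₂ (∈-∩⁺ v∈B v∈B')

NoEdgeFromTo-∪∩ : ∀ {G} {A B A' B' : VSet G} → Covers A B → Covers A' B' →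
                  NoEdgeFromTo G A B → NoEdgeFromTo G A' B' → NoEdgeFromTo G (A ∪ A') (B ∩ B')
NoEdgeFromTo-∪∩ {G} {A} {B} {A'} {B'} cover cover' noEdge noEdge' u v e u∈ v∈ =
  from-A-or-A' (∈-─ʳ u∈) (∈-─ʳ v∈) (∈-─ˡ v∈)
  where
  from-A-or-A' : u ∉ B ∩ B' → v ∉ A ∪ A' → v ∈ B ∩ B' → ⊥
  from-A-or-A' u∉B∩B' v∉A∪A' v∈B∩B' with u ∈? B | cover u | cover' u
  ... | no u∉B  | inj₁ u∈A | _ =
    noEdge u v e (∈-─⁺ u∈A u∉B) (∈-─⁺ (∈-∩ˡ v∈B∩B') (v∉A∪A' ∘ ∈-∪ˡ))
  ... | no u∉B  | inj₂ u∈B | _ = u∉B u∈B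
  ... | yes u∈B | _ | inj₁ u∈A' =
    noEdge' u v e (∈-─⁺ u∈A' (u∉B∩B' ∘ ∈-∩⁺ u∈B)) (∈-─⁺ (∈-∩ʳ v∈B∩B') (v∉A∪A' ∘ ∈-∪ʳ))
  ... | yes u∈B | _ | inj₂ u∈B' = u∉B∩B' (∈-∩⁺ u∈B u∈B')

-- Reversing G twice gives G back definitionally, so this is NoEdgeFromTo-∪∩
-- in the reverse digraph.
NoEdgeFromTo-∩∪ : ∀ {G} {A B A' B' : VSet G} → Covers A B → Covers A' B' →
                  NoEdgeFromTo G A B → NoEdgeFromTo G A' B' → NoEdgeFromTo G (A ∩ A') (B ∪ B')
NoEdgeFromTo-∩∪ {G} cover cover' noEdge noEdge' =
  NoEdgeFromTo-reverse {reverse G}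
    (NoEdgeFromTo-∪∩ {reverse G} (Covers-swap cover) (Covers-swap cover')
      (NoEdgeFromTo-reverse noEdge) (NoEdgeFromTo-reverse noEdge'))

Aligned : (G : Digraph) (A B A' B' : VSet G) → Set
Aligned G A B A' B' =
  (NoEdgeFromTo G A B × NoEdgeFromTo G A' B') ⊎ (NoEdgeFromTo G B A × NoEdgeFromTo G B' A')

aligned-or-opposed : ∀ {G} {A B A' B' : VSet G} → IsSeparation G A B → IsSeparation G A' B' →
                     Aligned G A B A' B' ⊎ Aligned G A B B' A'
aligned-or-opposed (_ , inj₁ d) (_ , inj₁ d') = inj₁ (inj₁ (d , d'))
aligned-or-opposed (_ , inj₂ d) (_ , inj₂ d') = inj₁ (inj₂ (d , d'))
aligned-or-opposed (_ , inj₁ d) (_ , inj₂ d') = inj₂ (inj₁ (d , d'))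
aligned-or-opposed (_ , inj₂ d) (_ , inj₁ d') = inj₂ (inj₂ (d , d'))

Aligned-flip : ∀ {G} {A B A' B' : VSet G} → Aligned G A B B' A' → Aligned G A' B' B A
Aligned-flip = [ inj₂ ∘ swap , inj₁ ∘ swap ]′

module _ {G : Digraph} {A B A' B' : VSet G}
         (S : IsSeparation G A B) (S' : IsSeparation G A' B') (aligned : Aligned G A B A' B') where

  IsSeparation-∪∩ : IsSeparation G (A ∪ A') (B ∩ B')
  IsSeparation-∪∩ = Covers-∪∩ (proj₁ S) (proj₁ S') , Sum.map
    (λ (d , d') → NoEdgeFromTo-∪∩ (proj₁ S) (proj₁ S') d d')
    (λ (d , d') → NoEdgeFromTo-∩∪ (Covers-swap (proj₁ S)) (Covers-swap (proj₁ S')) d d')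
    aligned

  IsSeparation-∩∪ : IsSeparation G (A ∩ A') (B ∪ B')
  IsSeparation-∩∪ = Covers-swap (Covers-∪∩ (Covers-swap (proj₁ S)) (Covers-swap (proj₁ S'))) , Sum.map
    (λ (d , d') → NoEdgeFromTo-∩∪ (proj₁ S) (proj₁ S') d d')
    (λ (d , d') → NoEdgeFromTo-∪∩ (Covers-swap (proj₁ S)) (Covers-swap (proj₁ S')) d d')
    aligned

order-crossing : ∀ {G} (A₁ B₁ A₂ B₂ : VSet G) →
  order {G} (A₁ ∪ B₂) (B₁ ∩ A₂) + order {G} (A₂ ∪ B₁) (B₂ ∩ A₁) ≤ order {G} A₁ B₁ + order {G} A₂ B₂
order-crossing A₁ B₁ A₂ B₂ =
  subst₂ (λ x y → ∣ (A₁ ∪ B₂) ∩ (B₁ ∩ A₂) ∣ + x ≤ ∣ A₁ ∩ B₁ ∣ + y)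
    (cong ∣_∣ (trans (∩-comm (A₁ ∩ B₂) (B₁ ∪ A₂)) (cong₂ _∩_ (∪-comm B₁ A₂) (∩-comm A₁ B₂))))
    (∣∩∣-comm B₂ A₂)
    (∣∪∩∣+∣∩∪∣≤∣∩∣+∣∩∣ A₁ B₁ B₂ A₂)

NoEdgeFromTo-∪ : ∀ {G} {A B : VSet G} (C : VSet G) → NoEdgeFromTo G A B → NoEdgeFromTo G (A ∪ C) (B ∪ C)
NoEdgeFromTo-∪ {G} C noEdge u v e u∈ v∈ = noEdge u v e (drop-C u∈) (drop-C v∈)
  where
  drop-C : ∀ {P Q : VSet G} {w} → w ∈ (P ∪ C) ─ (Q ∪ C) → w ∈ P ─ Q
  drop-C w∈ with ∈-∪⁻ (∈-─ˡ w∈)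
  ... | inj₁ w∈P = ∈-─⁺ w∈P (∈-─ʳ w∈ ∘ ∈-∪ˡ)
  ... | inj₂ w∈C = ⊥-elim (∈-─ʳ w∈ (∈-∪ʳ w∈C))

IsSeparation-∪ : ∀ {G} {A B : VSet G} (C : VSet G) → IsSeparation G A B → IsSeparation G (A ∪ C) (B ∪ C)
IsSeparation-∪ C (cover , noEdge) =
  Sum.map ∈-∪ˡ ∈-∪ˡ ∘ cover , Sum.map (NoEdgeFromTo-∪ C) (NoEdgeFromTo-∪ C) noEdge

∣∪⁅x⁆∩∪⁅x⁆∣≡1 : ∀ {n} (A B : Subset n) x → ∣ A ∩ B ∣ ≡ 0 → ∣ (A ∪ ⁅ x ⁆) ∩ (B ∪ ⁅ x ⁆) ∣ ≡ 1
∣∪⁅x⁆∩∪⁅x⁆∣≡1 A B x ∣A∩B∣≡0 = trans (cong ∣_∣ (⊆-antisym ⊆⁅x⁆ ⁅x⁆⊆)) (∣⁅x⁆∣≡1 x)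
  where
  ⊆⁅x⁆ : (A ∪ ⁅ x ⁆) ∩ (B ∪ ⁅ x ⁆) ⊆ ⁅ x ⁆
  ⊆⁅x⁆ y∈ with ∈-∪⁻ (∈-∩ˡ y∈) | ∈-∪⁻ (∈-∩ʳ y∈)
  ... | inj₂ y∈⁅x⁆ | _          = y∈⁅x⁆
  ... | inj₁ _     | inj₂ y∈⁅x⁆ = y∈⁅x⁆
  ... | inj₁ y∈A   | inj₁ y∈B   = ⊥-elim (∣p∣≡0⇒x∉p ∣A∩B∣≡0 (∈-∩⁺ y∈A y∈B))
  ⁅x⁆⊆ : ⁅ x ⁆ ⊆ (A ∪ ⁅ x ⁆) ∩ (B ∪ ⁅ x ⁆)
  ⁅x⁆⊆ y∈⁅x⁆ = ∈-∩⁺ (∈-∪ʳ y∈⁅x⁆) (∈-∪ʳ y∈⁅x⁆)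

NoCutVertex : (G : Digraph) → List (V G) → Set
NoCutVertex G xs = ∀ A B → IsSeparation G A B → order {G} A B ≡ 1 → AllIn {G} xs A →
                   ∃[ v ] (v ∈ B × v ∉ A) → ⊥

-- A separation of order 0 becomes one of order 1 by adding a vertex u ≠ v to
-- both sides; this is why two distinct vertices are needed.
order≤1⇒⊆ : ∀ {G xs} {A B : VSet G} {u₀ u₁ : V G} → NoCutVertex G xs → u₀ ≢ u₁ →
            IsSeparation G A B → order {G} A B ≤ 1 → AllIn {G} xs A → B ⊆ A
order≤1⇒⊆ {G} {xs} {A} {B} {u₀} {u₁} noCut u₀≢u₁ S order≤1 xs⊆A {v} v∈B with v ∈? A
... | yes v∈A = v∈A
... | no v∉A  = ⊥-elim (by-order (order {G} A B) refl order≤1)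
  where
  other : ∃[ u ] (u ≢ v)
  other with u₀ ≟ v
  ... | yes refl = u₁ , u₀≢u₁ ∘ sym
  ... | no u₀≢v  = u₀ , u₀≢v
  u : V G
  u = proj₁ other
  v∉A∪⁅u⁆ : v ∉ A ∪ ⁅ u ⁆
  v∉A∪⁅u⁆ v∈ = [ v∉A , (λ v∈⁅u⁆ → proj₂ other (sym (x∈⁅y⁆⇒x≡y u v∈⁅u⁆))) ]′ (∈-∪⁻ v∈)
  by-order : ∀ k → order {G} A B ≡ k → k ≤ 1 → ⊥
  by-order 0 ∣A∩B∣≡0 _ =
    noCut (A ∪ ⁅ u ⁆) (B ∪ ⁅ u ⁆) (IsSeparation-∪ ⁅ u ⁆ S) (∣∪⁅x⁆∩∪⁅x⁆∣≡1 A B u ∣A∩B∣≡0)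
          (All.map ∈-∪ˡ xs⊆A) (v , ∈-∪ˡ v∈B , v∉A∪⁅u⁆)
  by-order 1 ∣A∩B∣≡1 _ = noCut A B S ∣A∩B∣≡1 xs⊆A (v , v∈B , v∉A)
  by-order (suc (suc _)) _ (s≤s ())

module _ {G : Digraph} {X Y : VSet G} (cover : Covers X Y) (noEdge : NoEdgeFromTo G X Y) where

  edge-stays-in-─ : ∀ {u v} → E G u v → u ∈ X ─ Y → v ∉ X ∩ Y → v ∈ X ─ Y
  edge-stays-in-─ {u} {v} e u∈X─Y v∉X∩Y with v ∈? X | v ∈? Y
  ... | yes v∈X | yes v∈Y = ⊥-elim (v∉X∩Y (∈-∩⁺ v∈X v∈Y))
  ... | yes v∈X | no v∉Y  = ∈-─⁺ v∈X v∉Y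
  ... | no v∉X  | yes v∈Y = ⊥-elim (noEdge u v e u∈X─Y (∈-─⁺ v∈Y v∉X))
  ... | no v∉X  | no v∉Y  = ⊥-elim ([ v∉X , v∉Y ]′ (cover v))

  Linked-stays-in-─ : ∀ {u} xs → Linked (E G) (u ∷ xs) → (∀ v → v L.∈ xs → v ∉ X ∩ Y) →
                      u ∈ X ─ Y → ∀ {w} → w L.∈ u ∷ xs → w ∈ X ─ Y
  Linked-stays-in-─ _ _ _ u∈ (here refl) = u∈
  Linked-stays-in-─ [] _ _ _ (there ())
  Linked-stays-in-─ (x ∷ xs) (e ∷ linked) clear u∈ (there w∈) =
    Linked-stays-in-─ xs linked (λ v → clear v ∘ there) (edge-stays-in-─ e u∈ (clear x (here refl))) w∈

  Linked-reaches-last-in-─ : ∀ xs {v w} → Linked (E G) (xs ∷ʳ v) → (∀ y → y L.∈ xs ∷ʳ v → y ∉ X ∩ Y) →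
                             w L.∈ xs ∷ʳ v → w ∈ X ─ Y → v ∈ X ─ Y
  Linked-reaches-last-in-─ [] _ _ (here refl) w∈ = w∈
  Linked-reaches-last-in-─ [] _ _ (there ()) _
  Linked-reaches-last-in-─ (x ∷ xs) linked clear (there w∈xs) w∈ =
    Linked-reaches-last-in-─ xs (Data.List.Relation.Unary.Linked.tail linked) (λ y → clear y ∘ there) w∈xs w∈
  Linked-reaches-last-in-─ (x ∷ []) (e ∷ _) clear (here refl) x∈ =
    edge-stays-in-─ e x∈ (clear _ (there (here refl)))
  Linked-reaches-last-in-─ (x ∷ y ∷ xs) (e ∷ linked) clear (here refl) x∈ =
    Linked-reaches-last-in-─ (y ∷ xs) linked (λ z → clear z ∘ there) (here refl)
      (edge-stays-in-─ e x∈ (clear y (there (here refl))))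

module WallGeometry (m : ℕ) where
  open Wall m

  notLast-nothing : ∀ {p} (j : Fin (suc p)) → notLast j ≡ nothing → j ≡ fromℕ p
  notLast-nothing {zero}  zero    _  = refl
  notLast-nothing {suc p} zero    ()
  notLast-nothing {suc p} (suc j) eq with notLast j in eq′
  ... | nothing = cong suc (notLast-nothing j eq′)
  notLast-nothing {suc p} (suc j) () | just _

  notLast-just : ∀ {p} (j : Fin (suc p)) {l} → notLast j ≡ just l → j ≡ inject₁ l
  notLast-just {zero}  zero    ()
  notLast-just {suc p} zero    refl = refl
  notLast-just {suc p} (suc j) eq with notLast j in eq′
  notLast-just {suc p} (suc j) refl | just _ = cong suc (notLast-just j eq′)
  notLast-just {suc p} (suc j) () | nothing

  notLast-inject₁ : ∀ {p} (l : Fin p) → notLast (inject₁ l) ≡ just l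
  notLast-inject₁ {suc p} zero    = refl
  notLast-inject₁ {suc p} (suc l) rewrite notLast-inject₁ l = refl

  colOf : WV → Col
  colOf (end i _) = i
  colOf (sv i _)  = i
  colOf (tv i _)  = i

  rowOf : WV → Row
  rowOf (end _ false) = zero
  rowOf (end _ true)  = fromℕ (suc m)
  rowOf (sv _ l)      = midRow l
  rowOf (tv _ l)      = midRow l

  inV-midRow : ∀ i l → inV i (midRow l) ≡ sv i l
  inV-midRow i l rewrite notLast-inject₁ l = refl

  outV-midRow : ∀ i l → outV i (midRow l) ≡ tv i l
  outV-midRow i l rewrite notLast-inject₁ l = refl

  inV≡outV⊎split : ∀ i r → inV i r ≡ outV i r ⊎ ∃[ l ] (midRow l ≡ r × inV i r ≡ sv i l × outV i r ≡ tv i l)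
  inV≡outV⊎split i zero = inj₁ refl
  inV≡outV⊎split i (suc j) with notLast j in eq
  ... | nothing = inj₁ refl
  ... | just l  = inj₂ (l , cong suc (sym (notLast-just j eq)) , refl , refl)

  colOf-inV : ∀ i r → colOf (inV i r) ≡ i
  colOf-inV i zero = refl
  colOf-inV i (suc j) with notLast j
  ... | nothing = refl
  ... | just _  = refl

  colOf-outV : ∀ i r → colOf (outV i r) ≡ i
  colOf-outV i zero = refl
  colOf-outV i (suc j) with notLast j
  ... | nothing = refl
  ... | just _  = refl

  rowOf-inV : ∀ i r → rowOf (inV i r) ≡ r
  rowOf-inV i zero = refl
  rowOf-inV i (suc j) with notLast j in eq
  ... | nothing = cong suc (sym (notLast-nothing j eq))
  ... | just _  = cong suc (sym (notLast-just j eq))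

  rowOf-outV : ∀ i r → rowOf (outV i r) ≡ r
  rowOf-outV i zero = refl
  rowOf-outV i (suc j) with notLast j in eq
  ... | nothing = cong suc (sym (notLast-nothing j eq))
  ... | just _  = cong suc (sym (notLast-just j eq))

  col-even : ∀ i j → isEven (toℕ i) ≡ true →
             tailE (col i j) ≡ outV i (inject₁ j) × headE (col i j) ≡ inV i (suc j)
  col-even i j even rewrite even = refl , refl

  col-odd : ∀ i j → isEven (toℕ i) ≡ false →
            tailE (col i j) ≡ outV i (suc j) × headE (col i j) ≡ inV i (inject₁ j)
  col-odd i j odd rewrite odd = refl , refl

  colOf-tailE-col : ∀ i j → colOf (tailE (col i j)) ≡ i
  colOf-tailE-col i j with isEven (toℕ i)
  ... | true  = colOf-outV i (inject₁ j)
  ... | false = colOf-outV i (suc j)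

  colOf-headE-col : ∀ i j → colOf (headE (col i j)) ≡ i
  colOf-headE-col i j with isEven (toℕ i)
  ... | true  = colOf-inV i (suc j)
  ... | false = colOf-inV i (inject₁ j)

  toℕ-nextCol : ∀ i → suc (toℕ i) < 2 * k → toℕ (nextCol i) ≡ suc (toℕ i)
  toℕ-nextCol i lt = trans (toℕ-fromℕ< _) (m<n⇒m%n≡m lt)

  nextCol-last : ∀ i → suc (toℕ i) ≡ 2 * k → nextCol i ≡ zero
  nextCol-last i eq = toℕ-injective (trans (toℕ-fromℕ< _) (trans (cong (_% (2 * k)) eq) (n%n≡0 (2 * k))))

module WallFacts {G : Digraph} {m : ℕ} (W : CylWall G m) where
  open Wall m
  open WallGeometry m
  open CylWall W

  CycleIn : VSet G → Row → Set
  CycleIn S j = ∀ v → OnWallCycle j v → v ∈ S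

  IsEnd : WE → WV → Set
  IsEnd e x = x ≡ tailE e ⊎ x ≡ headE e

  ∈-path : ∀ e {v} → v L.∈ verts (path e) → ∃[ x ] (IsEnd e x × v ≡ φ x) ⊎ v L.∈ inner (path e)
  ∈-path e (here v≡) = inj₁ (tailE e , inj₁ refl , v≡)
  ∈-path e (there v∈) with ∈-++⁻ (inner (path e)) v∈
  ... | inj₁ v∈inner    = inj₂ v∈inner
  ... | inj₂ (here v≡) = inj₁ (headE e , inj₂ refl , v≡)

  φ-on-path⇒end : ∀ e {x} → φ x L.∈ verts (path e) → IsEnd e x
  φ-on-path⇒end e {x} φx∈ with ∈-path e φx∈
  ... | inj₁ (y , y-end , φx≡φy) = subst (IsEnd e) (φ-inj y x (sym φx≡φy)) y-end
  ... | inj₂ φx∈inner          = ⊥-elim (inner-branch e x φx∈inner)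

  paths-meet-at-end : ∀ e e' {v} → e ≢ e' → v L.∈ verts (path e) → v L.∈ verts (path e') →
                      ∃[ x ] (IsEnd e x × IsEnd e' x)
  paths-meet-at-end e e' e≢e' v∈e v∈e' with ∈-path e v∈e
  ... | inj₁ (x , x-end , refl) = x , x-end , φ-on-path⇒end e' v∈e'
  ... | inj₂ v∈inner with ∈-path e' v∈e'
  ...   | inj₁ (x , _ , refl)  = ⊥-elim (inner-branch e x v∈inner)
  ...   | inj₂ v∈inner'        = ⊥-elim (inner-disj e e' _ e≢e' v∈inner v∈inner')

  -- Cycles and columns are both classes of wall edges whose ends are labelled by
  -- the class; any such classes have disjoint images in G.
  module EdgeClasses {I : Set} (_≟ᴵ_ : (i j : I) → Dec (i ≡ j)) (label : WV → I) (InClass : I → WE → Set)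
                     (InClass-unique : ∀ {i j} e → InClass i e → InClass j e → i ≡ j)
                     (label-end : ∀ {i} e {x} → InClass i e → IsEnd e x → label x ≡ i) where

    Class : I → V G → Set
    Class i v = (∃[ e ] (InClass i e × v L.∈ verts (path e))) ⊎ (∃[ x ] (label x ≡ i × v ≡ φ x))

    private
      path-vs-vertex : ∀ {i j e x} → InClass i e → φ x L.∈ verts (path e) → label x ≡ j → i ≡ j
      path-vs-vertex {e = e} e∈i φx∈ refl = sym (label-end e e∈i (φ-on-path⇒end e φx∈))

    Class-disjoint : ∀ {i j v} → Class i v → Class j v → i ≡ j
    Class-disjoint (inj₂ (x , refl , v≡φx)) (inj₂ (y , refl , v≡φy)) = cong label (φ-inj x y (trans (sym v≡φx) v≡φy))
    Class-disjoint (inj₁ (e , e∈i , v∈)) (inj₂ (x , lx , refl)) = path-vs-vertex e∈i v∈ lx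
    Class-disjoint (inj₂ (x , lx , refl)) (inj₁ (e , e∈j , v∈)) = sym (path-vs-vertex e∈j v∈ lx)
    Class-disjoint {i} {j} (inj₁ (e , e∈i , v∈e)) (inj₁ (e' , e'∈j , v∈e')) with i ≟ᴵ j
    ... | yes i≡j = i≡j
    ... | no i≢j  with paths-meet-at-end e e' (λ { refl → i≢j (InClass-unique e e∈i e'∈j) }) v∈e v∈e'
    ...   | x , x-end , x-end' = trans (sym (label-end e e∈i x-end)) (label-end e' e'∈j x-end')

  rowOf-cycle-end : ∀ {j} e {x} → OnCycle j e → IsEnd e x → rowOf x ≡ j
  rowOf-cycle-end (split i l) refl (inj₁ refl) = refl
  rowOf-cycle-end (split i l) refl (inj₂ refl) = refl
  rowOf-cycle-end (cyc i j) refl (inj₁ refl) = rowOf-outV i j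
  rowOf-cycle-end (cyc i j) refl (inj₂ refl) = rowOf-inV (nextCol i) j
  rowOf-cycle-end (col i j) ()

  OnCycle-unique : ∀ {j j'} e → OnCycle j e → OnCycle j' e → j ≡ j'
  OnCycle-unique (split i l) refl refl = refl
  OnCycle-unique (cyc i j) refl refl = refl
  OnCycle-unique (col i j) ()

  ColumnEdge : Col → WE → Set
  ColumnEdge c (split i _) = i ≡ c
  ColumnEdge c (cyc _ _)   = ⊥
  ColumnEdge c (col i _)   = i ≡ c

  colOf-column-end : ∀ {c} e {x} → ColumnEdge c e → IsEnd e x → colOf x ≡ c
  colOf-column-end (split i l) refl (inj₁ refl) = refl
  colOf-column-end (split i l) refl (inj₂ refl) = refl
  colOf-column-end (col i j) refl (inj₁ refl) = colOf-tailE-col i j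
  colOf-column-end (col i j) refl (inj₂ refl) = colOf-headE-col i j
  colOf-column-end (cyc i j) ()

  ColumnEdge-unique : ∀ {c c'} e → ColumnEdge c e → ColumnEdge c' e → c ≡ c'
  ColumnEdge-unique (split i l) refl refl = refl
  ColumnEdge-unique (col i j) refl refl = refl
  ColumnEdge-unique (cyc i j) ()

  module Rows = EdgeClasses _≟_ rowOf OnCycle OnCycle-unique rowOf-cycle-end
  module Columns = EdgeClasses _≟_ colOf ColumnEdge ColumnEdge-unique colOf-column-end

  OnColumn : Col → V G → Set
  OnColumn = Columns.Class

  OnColumn-disjoint : ∀ {c c' v} → OnColumn c v → OnColumn c' v → c ≡ c'
  OnColumn-disjoint = Columns.Class-disjoint

  OnWallCycle-disjoint : ∀ {j j' v} → OnWallCycle j v → OnWallCycle j' v → j ≡ j'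
  OnWallCycle-disjoint on on' = Rows.Class-disjoint (inj₁ on) (inj₁ on')

  outV-on-column : ∀ i r → OnColumn i (φ (outV i r))
  outV-on-column i r = inj₂ (outV i r , colOf-outV i r , refl)

  outV-on-cycle : ∀ i j → OnWallCycle j (φ (outV i j))
  outV-on-cycle i j = cyc i j , refl , here refl

  inV-on-cycle : ∀ i j → OnWallCycle j (φ (inV i j))
  inV-on-cycle i j with inV≡outV⊎split i j
  ... | inj₁ in≡out = subst (OnWallCycle j) (cong φ (sym in≡out)) (outV-on-cycle i j)
  ... | inj₂ (l , l≡j , in≡ , _) = split i l , l≡j , here (cong φ in≡)

  module Spread {X Y : VSet G} (cover : Covers X Y) (noEdge : NoEdgeFromTo G X Y) where

    Inside : WV → Set
    Inside x = φ x ∈ X ─ Y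

    Clear : WE → Set
    Clear e = ∀ v → v L.∈ verts (path e) → v ∉ X ∩ Y

    along-path : ∀ e → Clear e → Inside (tailE e) → ∀ {w} → w L.∈ verts (path e) → w ∈ X ─ Y
    along-path e clear =
      Linked-stays-in-─ cover noEdge (inner (path e) ∷ʳ φ (headE e)) (linked (path e)) (λ v → clear v ∘ there)

    to-head : ∀ e → Clear e → ∀ {w} → w L.∈ verts (path e) → w ∈ X ─ Y → Inside (headE e)
    to-head e clear = Linked-reaches-last-in-─ cover noEdge (φ (tailE e) ∷ inner (path e)) (linked (path e)) clear

    along-edge : ∀ e {x y} → Clear e → tailE e ≡ x → headE e ≡ y → Inside x → Inside y
    along-edge e clear refl refl x∈ = to-head e clear (here refl) x∈

    through-vertex : ∀ i r → (∀ l → midRow l ≡ r → Clear (split i l)) → Inside (inV i r) → Inside (outV i r)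
    through-vertex i r clear in∈ with inV≡outV⊎split i r
    ... | inj₁ in≡out = subst Inside in≡out in∈
    ... | inj₂ (l , l≡r , in≡ , out≡) = along-edge (split i l) (clear l l≡r) (sym in≡) (sym out≡) in∈

    ClearColumn : Col → Set
    ClearColumn = Avoids OnColumn (X ∩ Y)

    clear-column-edge : ∀ {c} → ClearColumn c → ∀ e → ColumnEdge c e → Clear e
    clear-column-edge clear e e∈c v v∈ = clear v (inj₁ (e , e∈c , v∈))

    within-column : ∀ {c} → ClearColumn c → ∀ r → Inside (inV c r) → Inside (outV c r)
    within-column {c} clear r = through-vertex c r (λ l _ → clear-column-edge clear (split c l) refl)

    down-step : ∀ {c} → ClearColumn c → isEven (toℕ c) ≡ true →
                ∀ j → Inside (outV c (inject₁ j)) → Inside (inV c (suc j))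
    down-step {c} clear even j =
      uncurry (along-edge (col c j) (clear-column-edge clear (col c j) refl)) (col-even c j even)

    up-step : ∀ {c} → ClearColumn c → isEven (toℕ c) ≡ false →
              ∀ j → Inside (outV c (suc j)) → Inside (inV c (inject₁ j))
    up-step {c} clear odd j =
      uncurry (along-edge (col c j) (clear-column-edge clear (col c j) refl)) (col-odd c j odd)

    down-column : ∀ {c} → ClearColumn c → isEven (toℕ c) ≡ true →
                  ∀ d (a b : Row) → toℕ b ≡ suc (d + toℕ a) → Inside (outV c a) → Inside (inV c b)
    down-column clear even d a zero ()
    down-column {c} clear even zero a (suc j) b≡ a∈ =
      down-step clear even j (subst (Inside ∘ outV c) (toℕ-injective (trans (sym (suc-injective b≡)) (sym (toℕ-inject₁ j)))) a∈)
    down-column clear even (suc d) a (suc j) b≡ a∈ =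
      down-step clear even j (within-column clear (inject₁ j)
        (down-column clear even d a (inject₁ j) (trans (toℕ-inject₁ j) (suc-injective b≡)) a∈))

    up-column : ∀ {c} → ClearColumn c → isEven (toℕ c) ≡ false →
                ∀ d (a b : Row) → toℕ a ≡ suc (d + toℕ b) → Inside (outV c a) → Inside (inV c b)
    up-column clear odd d zero b ()
    up-column {c} clear odd zero (suc j) b a≡ a∈ =
      subst (Inside ∘ inV c) (toℕ-injective (trans (toℕ-inject₁ j) (suc-injective a≡))) (up-step clear odd j a∈)
    up-column clear odd (suc d) (suc j) b a≡ a∈ =
      up-column clear odd d (inject₁ j) b (trans (toℕ-inject₁ j) (suc-injective a≡))
        (within-column clear (inject₁ j) (up-step clear odd j a∈))

    ClearCycle : Row → Set
    ClearCycle = Avoids OnWallCycle (X ∩ Y)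

    clear-cycle-edge : ∀ {j} → ClearCycle j → ∀ e → OnCycle j e → Clear e
    clear-cycle-edge clear e e∈j v v∈ = clear v (e , e∈j , v∈)

    within-cycle : ∀ {j} → ClearCycle j → ∀ i → Inside (inV i j) → Inside (outV i j)
    within-cycle {j} clear i = through-vertex i j (λ l l≡j → clear-cycle-edge clear (split i l) l≡j)

    next-column : ∀ {j} → ClearCycle j → ∀ i → Inside (inV i j) → Inside (inV (nextCol i) j)
    next-column {j} clear i in∈ =
      along-edge (cyc i j) (clear-cycle-edge clear (cyc i j) refl) refl refl (within-cycle clear i in∈)

    to-column-zero : ∀ {j} → ClearCycle j → ∀ d i → suc (d + toℕ i) ≡ 2 * k → Inside (inV i j) → Inside (inV zero j)
    to-column-zero {j} clear zero i i-last in∈ = subst (λ c → Inside (inV c j)) (nextCol-last i i-last) (next-column clear i in∈)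
    to-column-zero {j} clear (suc d) i eq in∈ = to-column-zero clear d (nextCol i) eq′ (next-column clear i in∈)
      where
      i+1<2k : suc (toℕ i) < 2 * k
      i+1<2k = subst (suc (suc (toℕ i)) ≤_) eq (s≤s (s≤s (m≤n+m (toℕ i) d)))
      eq′ : suc (d + toℕ (nextCol i)) ≡ 2 * k
      eq′ = trans (cong (λ t → suc (d + t)) (toℕ-nextCol i i+1<2k)) (trans (cong suc (+-suc d (toℕ i))) eq)

    from-column-zero : ∀ {j} → ClearCycle j → Inside (inV zero j) → ∀ d (d<2k : d < 2 * k) → Inside (inV (fromℕ< d<2k) j)
    from-column-zero clear zero∈ zero _ = zero∈
    from-column-zero {j} clear zero∈ (suc d) d+1<2k =
      subst (λ c → Inside (inV c j)) next≡ (next-column clear _ (from-column-zero clear zero∈ d d<2k))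
      where
      d<2k : d < 2 * k
      d<2k = ≤-trans (n≤1+n (suc d)) d+1<2k
      next≡ : nextCol (fromℕ< d<2k) ≡ fromℕ< d+1<2k
      next≡ = toℕ-injective (trans (toℕ-nextCol _ (subst (λ t → suc t < 2 * k) (sym (toℕ-fromℕ< d<2k)) d+1<2k))
                                   (trans (cong suc (toℕ-fromℕ< d<2k)) (sym (toℕ-fromℕ< d+1<2k))))

    all-columns : ∀ {j} → ClearCycle j → ∀ i → Inside (inV i j) → ∀ i' → Inside (inV i' j)
    all-columns {j} clear i in∈ i' =
      subst (λ c → Inside (inV c j)) (fromℕ<-toℕ i' (toℕ<n i'))
        (from-column-zero clear (to-column-zero clear (2 * k ∸ suc (toℕ i)) i eq in∈) (toℕ i') (toℕ<n i'))
      where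
      eq : suc (2 * k ∸ suc (toℕ i) + toℕ i) ≡ 2 * k
      eq = trans (sym (+-suc (2 * k ∸ suc (toℕ i)) (toℕ i))) (m∸n+n≡m (toℕ<n i))

    entry-column : ∀ {j} → ClearCycle j → ∀ e → OnCycle j e → Inside (headE e) → ∃[ i ] Inside (inV i j)
    entry-column clear (split i l) refl tv∈ =
      nextCol i , along-edge (cyc i (midRow l)) (clear-cycle-edge clear (cyc i (midRow l)) refl)
                             (outV-midRow i l) refl tv∈
    entry-column clear (cyc i j) refl in∈ = nextCol i , in∈
    entry-column clear (col i j) ()

    cycle-in-─ : ∀ {j} → ClearCycle j → ∀ {w} → OnWallCycle j w → w ∈ X ─ Y → CycleIn (X ─ Y) j
    cycle-in-─ {j} clear (e , e∈j , w∈) w∈X─Y = on-edge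
      where
      entry = entry-column clear e e∈j (to-head e (clear-cycle-edge clear e e∈j) w∈ w∈X─Y)
      every-column : ∀ i → Inside (inV i j)
      every-column = all-columns clear (proj₁ entry) (proj₂ entry)
      on-edge : CycleIn (X ─ Y) j
      on-edge v (split i l , refl , v∈) =
        along-path (split i l) (clear-cycle-edge clear (split i l) refl) (subst Inside (inV-midRow i l) (every-column i)) v∈
      on-edge v (cyc i j , refl , v∈) =
        along-path (cyc i j) (clear-cycle-edge clear (cyc i j) refl) (within-cycle clear i (every-column i)) v∈
      on-edge v (col i j , () , _)

  distinct-vertices : φ (end zero false) ≢ φ (end zero true)
  distinct-vertices eq with φ-inj _ _ eq
  ... | ()

  cycle-side-oriented : ∀ {X Y} → Covers X Y → NoEdgeFromTo G X Y →
                        ∀ j → Avoids OnWallCycle (X ∩ Y) j → CycleIn X j ⊎ CycleIn Y j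
  cycle-side-oriented {X} {Y} cover noEdge j clear = by-v₀ (φ (outV zero j) ∈? X ─ Y)
    where
    open Spread cover noEdge
    by-v₀ : Dec (φ (outV zero j) ∈ X ─ Y) → CycleIn X j ⊎ CycleIn Y j
    by-v₀ (yes v₀∈) = inj₁ (λ v on → ∈-─ˡ (cycle-in-─ clear (outV-on-cycle zero j) v₀∈ v on))
    by-v₀ (no v₀∉)  = inj₂ in-Y
      where
      in-Y : CycleIn Y j
      in-Y v on with v ∈? Y | cover v
      ... | yes v∈Y | _        = v∈Y
      ... | no v∉Y  | inj₂ v∈Y = ⊥-elim (v∉Y v∈Y)
      ... | no v∉Y  | inj₁ v∈X = ⊥-elim (v₀∉ (cycle-in-─ clear on (∈-─⁺ v∈X v∉Y) _ (outV-on-cycle zero j)))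

  cycle-side : ∀ {X Y} → IsSeparation G X Y → ∀ j → Avoids OnWallCycle (X ∩ Y) j → CycleIn X j ⊎ CycleIn Y j
  cycle-side (cover , inj₁ noEdge) j clear = cycle-side-oriented cover noEdge j clear
  cycle-side (cover , inj₂ noEdge) j clear =
    Sum.swap (cycle-side-oriented (Covers-swap cover) noEdge j
               (λ v on v∈ → clear v on (∈-∩⁺ (∈-∩ʳ v∈) (∈-∩ˡ v∈))))

  CycleIn? : ∀ S j → Dec (CycleIn S j)
  CycleIn? S j = map′ to from
    (all? (λ i → All.all? (_∈? S) (verts (path (cyc i j)))) ×-dec
     all? (λ i → all? (λ l → (midRow l ≟ j) →-dec All.all? (_∈? S) (verts (path (split i l))))))
    where
    EdgesIn : Set
    EdgesIn = (∀ i → All (_∈ S) (verts (path (cyc i j)))) ×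
              (∀ i l → midRow l ≡ j → All (_∈ S) (verts (path (split i l))))
    to : EdgesIn → CycleIn S j
    to (on-cyc , on-split) v (cyc i _ , refl , v∈)  = All.lookup (on-cyc i) v∈
    to (on-cyc , on-split) v (split i l , l≡j , v∈) = All.lookup (on-split i l l≡j) v∈
    to _                   v (col _ _ , () , _)
    from : CycleIn S j → EdgesIn
    from j⊆S = (λ i → All.tabulate (λ v∈ → j⊆S _ (cyc i j , refl , v∈)))
             , (λ i l l≡j → All.tabulate (λ v∈ → j⊆S _ (split i l , l≡j , v∈)))

  ContainsMajority? : ∀ S → Dec (ContainsMajority S W)
  ContainsMajority? S = any? (CycleIn? S)

module _ {G : Digraph} {m : ℕ} (W : CylWall G (suc m)) where
  open Wall (suc m)
  open WallGeometry (suc m)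
  open CylWall W
  open WallFacts W

  private
    6≤2k : 6 ≤ 2 * k
    6≤2k = s≤s (s≤s (s≤s (≤-trans (s≤s (s≤s (s≤s z≤n))) (m≤n+m _ m))))

    column : Fin 6 → Col
    column x = fromℕ< (<-≤-trans (toℕ<n x) 6≤2k)

    toℕ-column : ∀ x → toℕ (column x) ≡ toℕ x
    toℕ-column x = toℕ-fromℕ< _

    column-injective : ∀ {x y} → column x ≡ column y → x ≡ y
    column-injective {x} {y} eq = toℕ-injective (trans (sym (toℕ-column x)) (trans (cong toℕ eq) (toℕ-column y)))

  -- If cycle a lies in X and cycle b in Y, three pairwise disjoint columns of
  -- the same direction lead from a to b, and each must meet X ∩ Y.
  module _ {X Y : VSet G} (cover : Covers X Y) (noEdge : NoEdgeFromTo G X Y) (∣X∩Y∣≤2 : ∣ X ∩ Y ∣ ≤ 2)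
           {a b : Row} (a⊆X : CycleIn X a) (b⊆Y : CycleIn Y b) where
    open Spread cover noEdge

    private
      blocked : ∀ c → (ClearColumn c → Inside (outV c a) → Inside (inV c b)) → ¬ ClearColumn c
      blocked c walk clear = ∈-─ʳ (walk clear start) (b⊆Y _ (inV-on-cycle c b))
        where
        out∈X : φ (outV c a) ∈ X
        out∈X = a⊆X _ (outV-on-cycle c a)
        start : Inside (outV c a)
        start = ∈-─⁺ out∈X (λ out∈Y → clear _ (outV-on-column c a) (∈-∩⁺ out∈X out∈Y))

      blocked-down : ∀ {d} → toℕ b ≡ suc (d + toℕ a) → ∀ x → isEven (toℕ x) ≡ true → ¬ ClearColumn (column x)
      blocked-down b≡ x even =
        blocked (column x) (λ clear → down-column clear (trans (cong isEven (toℕ-column x)) even) _ a b b≡)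

      blocked-up : ∀ {d} → toℕ a ≡ suc (d + toℕ b) → ∀ x → isEven (toℕ x) ≡ false → ¬ ClearColumn (column x)
      blocked-up a≡ x odd =
        blocked (column x) (λ clear → up-column clear (trans (cong isEven (toℕ-column x)) odd) _ a b a≡)

      meets-on-row : a ≡ b → ∀ x → ¬ ClearColumn (column x)
      meets-on-row refl x clear =
        clear _ (outV-on-column (column x) a) (∈-∩⁺ (a⊆X _ (outV-on-cycle _ a)) (b⊆Y _ (outV-on-cycle _ a)))

      three-columns : ∀ {x y z} → x ≢ y → x ≢ z → y ≢ z →
                      ¬ ClearColumn (column x) → ¬ ClearColumn (column y) → ¬ ClearColumn (column z) → ⊥
      three-columns x≢y x≢z y≢z = ∣p∣≤2⇒¬meets-3-disjoint OnColumn-disjoint ∣X∩Y∣≤2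
        (x≢y ∘ column-injective) (x≢z ∘ column-injective) (y≢z ∘ column-injective)

      by-position : Tri (toℕ a < toℕ b) (toℕ a ≡ toℕ b) (toℕ b < toℕ a) → ⊥
      by-position (tri≈ _ a≡b _) = three-columns {# 0} {# 1} {# 2} (λ ()) (λ ()) (λ ())
        (meets-on-row (toℕ-injective a≡b) (# 0)) (meets-on-row (toℕ-injective a≡b) (# 1))
        (meets-on-row (toℕ-injective a≡b) (# 2))
      by-position (tri< a<b _ _) with m<n⇒n≡1+o+m a<b
      ... | _ , b≡ = three-columns {# 0} {# 2} {# 4} (λ ()) (λ ()) (λ ())
        (blocked-down b≡ (# 0) refl) (blocked-down b≡ (# 2) refl) (blocked-down b≡ (# 4) refl)
      by-position (tri> _ _ b<a) with m<n⇒n≡1+o+m b<a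
      ... | _ , a≡ = three-columns {# 1} {# 3} {# 5} (λ ()) (λ ()) (λ ())
        (blocked-up a≡ (# 1) refl) (blocked-up a≡ (# 3) refl) (blocked-up a≡ (# 5) refl)

    ¬majority-on-both-sides-oriented : ⊥
    ¬majority-on-both-sides-oriented = by-position (<-cmp (toℕ a) (toℕ b))

  ¬majority-on-both-sides : ∀ {A B} → IsSeparation G A B → order {G} A B ≤ 2 →
                            ContainsMajority A W → ContainsMajority B W → ⊥
  ¬majority-on-both-sides (cover , inj₁ noEdge) order≤2 (a , a⊆A) (b , b⊆B) =
    ¬majority-on-both-sides-oriented cover noEdge order≤2 a⊆A b⊆B
  ¬majority-on-both-sides {A} {B} (cover , inj₂ noEdge) order≤2 (a , a⊆A) (b , b⊆B) =
    ¬majority-on-both-sides-oriented (Covers-swap cover) noEdge (subst (_≤ 2) (∣∩∣-comm A B) order≤2) b⊆B a⊆A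

-- A cycle of W avoiding B₂ ∩ A₁ lies on the A₂ ∪ B₁ side of T unless it meets the
-- separator of T; on that side it must meet the separators of both S₁ and S₂,
-- for otherwise S₁ or S₂ would see the majority of W on both of its sides.
-- Four disjoint cycles cannot all do this with three separators of order ≤ 2.
module _ {G : Digraph} {m : ℕ} (W : CylWall G (suc (suc m))) {A₁ B₁ A₂ B₂ : VSet G}
         (S₁ : IsSeparation G A₁ B₁) (o₁ : order {G} A₁ B₁ ≤ 2)
         (S₂ : IsSeparation G A₂ B₂) (o₂ : order {G} A₂ B₂ ≤ 2)
         (T : IsSeparation G (A₂ ∪ B₁) (B₂ ∩ A₁)) (oT : order {G} (A₂ ∪ B₁) (B₂ ∩ A₁) ≤ 2)
         (maj₁ : ContainsMajority A₁ W) (maj₂ : ContainsMajority B₂ W) where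
  open Wall (suc (suc m))
  open CylWall W
  open WallFacts W

  private
    Meets : VSet G → Row → Set
    Meets S r = ¬ Avoids OnWallCycle S r

    MeetsT MeetsBoth Kind : Row → Set
    MeetsT r = Meets ((A₂ ∪ B₁) ∩ (B₂ ∩ A₁)) r
    MeetsBoth r = Meets (A₁ ∩ B₁) r × Meets (A₂ ∩ B₂) r
    Kind r = MeetsT r ⊎ MeetsBoth r

    meets-S₁ : ∀ {r} → CycleIn (A₂ ∪ B₁) r → Meets (A₁ ∩ B₁) r
    meets-S₁ {r} r⊆ avoid with cycle-side S₁ r avoid
    ... | inj₂ r⊆B₁ = ¬majority-on-both-sides W S₁ o₁ maj₁ (r , r⊆B₁)
    ... | inj₁ r⊆A₁ = ¬majority-on-both-sides W S₂ o₂ (r , r⊆A₂) maj₂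
      where
      r⊆A₂ : CycleIn A₂ r
      r⊆A₂ v on = [ (λ v∈A₂ → v∈A₂) , (λ v∈B₁ → ⊥-elim (avoid v on (∈-∩⁺ (r⊆A₁ v on) v∈B₁))) ]′ (∈-∪⁻ (r⊆ v on))

    meets-S₂ : ∀ {r} → CycleIn (A₂ ∪ B₁) r → Meets (A₂ ∩ B₂) r
    meets-S₂ {r} r⊆ avoid with cycle-side S₂ r avoid
    ... | inj₁ r⊆A₂ = ¬majority-on-both-sides W S₂ o₂ (r , r⊆A₂) maj₂
    ... | inj₂ r⊆B₂ = ¬majority-on-both-sides W S₁ o₁ maj₁ (r , r⊆B₁)
      where
      r⊆B₁ : CycleIn B₁ r
      r⊆B₁ v on = [ (λ v∈A₂ → ⊥-elim (avoid v on (∈-∩⁺ v∈A₂ (r⊆B₂ v on)))) , (λ v∈B₁ → v∈B₁) ]′ (∈-∪⁻ (r⊆ v on))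

    row-kind : ¬ ContainsMajority (B₂ ∩ A₁) W → ∀ r → ¬ ¬ Kind r
    row-kind none r ¬kind = ¬kind (inj₂ (meets-S₁ r⊆A₂∪B₁ , meets-S₂ r⊆A₂∪B₁))
      where
      avoids-T : Avoids OnWallCycle ((A₂ ∪ B₁) ∩ (B₂ ∩ A₁)) r
      avoids-T v on v∈ = ¬kind (inj₁ (λ avoid → avoid v on v∈))
      r⊆A₂∪B₁ : CycleIn (A₂ ∪ B₁) r
      r⊆A₂∪B₁ = [ (λ r⊆ → r⊆) , (λ r⊆ → ⊥-elim (none (r , r⊆))) ]′ (cycle-side T r avoids-T)

    three-T : ∀ {r s t} → r ≢ s → r ≢ t → s ≢ t → MeetsT r → MeetsT s → MeetsT t → ⊥
    three-T = ∣p∣≤2⇒¬meets-3-disjoint OnWallCycle-disjoint oT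

    three-both : ∀ {r s t} → r ≢ s → r ≢ t → s ≢ t → MeetsBoth r → MeetsBoth s → MeetsBoth t → ⊥
    three-both r≢s r≢t s≢t (r₁ , _) (s₁ , _) (t₁ , _) =
      ∣p∣≤2⇒¬meets-3-disjoint OnWallCycle-disjoint o₁ r≢s r≢t s≢t r₁ s₁ t₁

    -- the separator of T lies in the union of those of S₁ and S₂
    two-both : ∀ {r s t} → r ≢ s → r ≢ t → s ≢ t → MeetsBoth r → MeetsBoth s → MeetsT t → ⊥
    two-both r≢s r≢t s≢t (r₁ , r₂) (s₁ , s₂) t-meets = t-meets λ v on v∈T →
      [ (λ v∈A₂ → ∣p∣≤2⇒¬meets-3-disjoint OnWallCycle-disjoint o₂ r≢s r≢t s≢t r₂ s₂
                    (λ avoid → avoid v on (∈-∩⁺ v∈A₂ (∈-∩ˡ (∈-∩ʳ v∈T)))))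
      , (λ v∈B₁ → ∣p∣≤2⇒¬meets-3-disjoint OnWallCycle-disjoint o₁ r≢s r≢t s≢t r₁ s₁
                    (λ avoid → avoid v on (∈-∩⁺ (∈-∩ʳ (∈-∩ʳ v∈T)) v∈B₁)))
      ]′ (∈-∪⁻ (∈-∩ˡ v∈T))

    count : Kind (# 0) → Kind (# 1) → Kind (# 2) → Kind (# 3) → ⊥
    count (inj₁ a) (inj₁ b) (inj₁ c) _        = three-T (λ ()) (λ ()) (λ ()) a b c
    count (inj₁ a) (inj₁ b) (inj₂ _) (inj₁ d) = three-T (λ ()) (λ ()) (λ ()) a b d
    count (inj₁ a) (inj₂ _) (inj₁ c) (inj₁ d) = three-T (λ ()) (λ ()) (λ ()) a c d
    count (inj₂ _) (inj₁ b) (inj₁ c) (inj₁ d) = three-T (λ ()) (λ ()) (λ ()) b c d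
    count (inj₂ a) (inj₂ b) (inj₂ c) _        = three-both (λ ()) (λ ()) (λ ()) a b c
    count (inj₂ a) (inj₂ b) (inj₁ _) (inj₂ d) = three-both (λ ()) (λ ()) (λ ()) a b d
    count (inj₂ a) (inj₁ _) (inj₂ c) (inj₂ d) = three-both (λ ()) (λ ()) (λ ()) a c d
    count (inj₁ _) (inj₂ b) (inj₂ c) (inj₂ d) = three-both (λ ()) (λ ()) (λ ()) b c d
    count (inj₁ a) (inj₁ _) (inj₂ c) (inj₂ d) = two-both (λ ()) (λ ()) (λ ()) c d a
    count (inj₁ a) (inj₂ b) (inj₁ _) (inj₂ d) = two-both (λ ()) (λ ()) (λ ()) b d a
    count (inj₁ a) (inj₂ b) (inj₂ c) (inj₁ _) = two-both (λ ()) (λ ()) (λ ()) b c a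
    count (inj₂ a) (inj₁ b) (inj₁ _) (inj₂ d) = two-both (λ ()) (λ ()) (λ ()) a d b
    count (inj₂ a) (inj₁ b) (inj₂ c) (inj₁ _) = two-both (λ ()) (λ ()) (λ ()) a c b
    count (inj₂ a) (inj₂ b) (inj₁ c) (inj₁ _) = two-both (λ ()) (λ ()) (λ ()) a b c

  majority-in-crossing : ContainsMajority (B₂ ∩ A₁) W
  majority-in-crossing =
    decidable-stable (ContainsMajority? (B₂ ∩ A₁)) λ none →
      row-kind none (# 0) λ k₀ → row-kind none (# 1) λ k₁ →
      row-kind none (# 2) λ k₂ → row-kind none (# 3) λ k₃ → count k₀ k₁ k₂ k₃

module _ {n : ℕ} {A B A' B' : Subset n} where

  ─∪─⊆ˡ : B' ─ A' ⊆ B → (B ─ A) ∪ (B' ─ A') ⊆ B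
  ─∪─⊆ˡ B'─A'⊆B x∈ = [ ∈-─ˡ , B'─A'⊆B ]′ (∈-∪⁻ x∈)

  ─∪─⊆ʳ : B ─ A ⊆ B' → (B ─ A) ∪ (B' ─ A') ⊆ B'
  ─∪─⊆ʳ B─A⊆B' x∈ = [ B─A⊆B' , ∈-─ˡ ]′ (∈-∪⁻ x∈)

  ─∪─⊆∪ : (B ─ A) ∪ (B' ─ A') ⊆ B ∪ B'
  ─∪─⊆∪ x∈ = [ ∈-∪ˡ ∘ ∈-─ˡ , ∈-∪ʳ ∘ ∈-─ˡ ]′ (∈-∪⁻ x∈)

  ∩⊆∪⇒─∩─-empty : B ∩ B' ⊆ A ∪ A' → Empty ((B ─ A) ∩ (B' ─ A'))
  ∩⊆∪⇒─∩─-empty B∩B'⊆A∪A' (x , x∈) =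
    [ ∈-─ʳ (∈-∩ˡ x∈) , ∈-─ʳ (∈-∩ʳ x∈) ]′ (∈-∪⁻ (B∩B'⊆A∪A' (∈-∩⁺ (∈-─ˡ (∈-∩ˡ x∈)) (∈-─ˡ (∈-∩ʳ x∈)))))

  ∩⊆∪⇒─⊆ : Covers A' B' → B ∩ A' ⊆ A ∪ B' → B ─ A ⊆ B'
  ∩⊆∪⇒─⊆ cover' B∩A'⊆A∪B' {x} x∈ with cover' x
  ... | inj₂ x∈B' = x∈B'
  ... | inj₁ x∈A' = [ (λ x∈A → ⊥-elim (∈-─ʳ x∈ x∈A)) , (λ x∈B' → x∈B') ]′ (∈-∪⁻ (B∩A'⊆A∪B' (∈-∩⁺ (∈-─ˡ x∈) x∈A')))

─∩∩─-empty : ∀ {n} (P Q R A : Subset n) → Empty ((P ─ A) ∩ ((Q ∩ A) ─ R))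
─∩∩─-empty _ _ _ _ (x , x∈) = ∈-─ʳ (∈-∩ˡ x∈) (∈-∩ʳ (∈-─ˡ (∈-∩ʳ x∈)))

∩─∩─-empty : ∀ {n} (P Q R A : Subset n) → Empty (((Q ∩ A) ─ R) ∩ (P ─ A))
∩─∩─-empty _ _ _ _ (x , x∈) = ∈-─ʳ (∈-∩ʳ x∈) (∈-∩ʳ (∈-─ˡ (∈-∩ˡ x∈)))

Conclusion : (G : Digraph) → List (V G) → (A₁ B₁ A₂ B₂ : VSet G) →
             ∀ {m₁ m₂} → CylWall G m₁ → CylWall G m₂ → Set
Conclusion G xs A₁ B₁ A₂ B₂ W₁ W₂ =
  (∃[ A ] ∃[ B ] (IsSeparation G A B × order {G} A B ≡ 2 ×
      AllIn {G} xs A × ((B₁ ─ A₁) ∪ (B₂ ─ A₂)) ⊆ B))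
  ⊎
  (∃[ A₁' ] ∃[ B₁' ] ∃[ A₂' ] ∃[ B₂' ]
     (IsSeparation G A₁' B₁' × order {G} A₁' B₁' ≡ 2 ×
      IsSeparation G A₂' B₂' × order {G} A₂' B₂' ≡ 2 ×
      AllIn {G} xs A₁' × AllIn {G} xs A₂' ×
      ContainsMajority B₁' W₁ × ContainsMajority B₂' W₂ ×
      Empty ((B₁' ─ A₁') ∩ (B₂' ─ A₂')) ×
      (((A₁' , B₁') ≡ (A₁ , B₁)) ⊎ ((A₂' , B₂') ≡ (A₂ , B₂)))))

module _ {G : Digraph} {xs : List (V G)} (noCut : NoCutVertex G xs) {u₀ u₁ : V G} (u₀≢u₁ : u₀ ≢ u₁)
         {A₁ B₁ A₂ B₂ : VSet G}
         (S₁ : IsSeparation G A₁ B₁) (o₁ : order {G} A₁ B₁ ≡ 2)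
         (S₂ : IsSeparation G A₂ B₂) (o₂ : order {G} A₂ B₂ ≡ 2)
         (xs⊆A₁∩A₂ : AllIn {G} xs (A₁ ∩ A₂)) where

  private
    xs⊆A₁ : AllIn {G} xs A₁
    xs⊆A₁ = All.map ∈-∩ˡ xs⊆A₁∩A₂

    xs⊆A₂ : AllIn {G} xs A₂
    xs⊆A₂ = All.map ∈-∩ʳ xs⊆A₁∩A₂

    small : ∀ {A B} → IsSeparation G A B → order {G} A B ≤ 1 → AllIn {G} xs A → B ⊆ A
    small = order≤1⇒⊆ noCut u₀≢u₁

  uncross-aligned : Aligned G A₁ B₁ A₂ B₂ → ∀ {m₁ m₂} (W₁ : CylWall G m₁) (W₂ : CylWall G m₂) →
                    ContainsMajority B₁ W₁ → ContainsMajority B₂ W₂ → Conclusion G xs A₁ B₁ A₂ B₂ W₁ W₂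
  uncross-aligned aligned W₁ W₂ maj₁ maj₂ =
    by-orders (order {G} (A₁ ∪ A₂) (B₁ ∩ B₂) ≤? 1) (order {G} (A₁ ∩ A₂) (B₁ ∪ B₂) ≤? 1)
    where
    join : IsSeparation G (A₁ ∪ A₂) (B₁ ∩ B₂)
    join = IsSeparation-∪∩ S₁ S₂ aligned
    meet : IsSeparation G (A₁ ∩ A₂) (B₁ ∪ B₂)
    meet = IsSeparation-∩∪ S₁ S₂ aligned
    sum : order {G} (A₁ ∪ A₂) (B₁ ∩ B₂) + order {G} (A₁ ∩ A₂) (B₁ ∪ B₂) ≤ 4
    sum = ≤-trans (∣∪∩∣+∣∩∪∣≤∣∩∣+∣∩∣ A₁ B₁ A₂ B₂) (≤-reflexive (cong₂ _+_ o₁ o₂))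
    by-orders : Dec (order {G} (A₁ ∪ A₂) (B₁ ∩ B₂) ≤ 1) → Dec (order {G} (A₁ ∩ A₂) (B₁ ∪ B₂) ≤ 1) →
                Conclusion G xs A₁ B₁ A₂ B₂ W₁ W₂
    by-orders (yes join≤1) _ =
      inj₂ (A₁ , B₁ , A₂ , B₂ , S₁ , o₁ , S₂ , o₂ , xs⊆A₁ , xs⊆A₂ , maj₁ , maj₂ ,
            ∩⊆∪⇒─∩─-empty (small join join≤1 (All.map ∈-∪ˡ xs⊆A₁)) , inj₁ refl)
    by-orders (no _) (yes meet≤1) = inj₁ (A₂ , B₂ , S₂ , o₂ , xs⊆A₂ , ─∪─⊆ʳ B₁─A₁⊆B₂)
      where
      B₁─A₁⊆B₂ : B₁ ─ A₁ ⊆ B₂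
      B₁─A₁⊆B₂ x∈ = ⊥-elim (∈-─ʳ x∈ (∈-∩ˡ (small meet meet≤1 xs⊆A₁∩A₂ (∈-∪ˡ (∈-─ˡ x∈)))))
    by-orders (no join≰1) (no meet≰1) =
      inj₁ (A₁ ∩ A₂ , B₁ ∪ B₂ , meet , m+n≤4⇒n≡2 sum join≰1 meet≰1 , xs⊆A₁∩A₂ , ─∪─⊆∪)

  uncross-opposed : Aligned G A₁ B₁ B₂ A₂ →
                    ∀ {m₁ m₂} (W₁ : CylWall G (suc (suc m₁))) (W₂ : CylWall G (suc (suc m₂))) →
                    ContainsMajority B₁ W₁ → ContainsMajority B₂ W₂ →
                    SeparatesMajorities A₁ B₁ W₁ W₂ ⊎ SeparatesMajorities A₂ B₂ W₁ W₂ →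
                    Conclusion G xs A₁ B₁ A₂ B₂ W₁ W₂
  uncross-opposed opposed W₁ W₂ maj₁ maj₂ separated =
    by-orders (order {G} (A₁ ∪ B₂) (B₁ ∩ A₂) ≤? 1) (order {G} (A₂ ∪ B₁) (B₂ ∩ A₁) ≤? 1)
    where
    T₁ : IsSeparation G (A₁ ∪ B₂) (B₁ ∩ A₂)
    T₁ = IsSeparation-∪∩ S₁ (IsSeparation-swap S₂) opposed
    T₂ : IsSeparation G (A₂ ∪ B₁) (B₂ ∩ A₁)
    T₂ = IsSeparation-∪∩ S₂ (IsSeparation-swap S₁) (Aligned-flip opposed)
    sum : order {G} (A₁ ∪ B₂) (B₁ ∩ A₂) + order {G} (A₂ ∪ B₁) (B₂ ∩ A₁) ≤ 4
    sum = ≤-trans (order-crossing {G} A₁ B₁ A₂ B₂) (≤-reflexive (cong₂ _+_ o₁ o₂))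
    tight : order {G} (A₁ ∪ B₂) (B₁ ∩ A₂) ≡ 2 → order {G} (A₂ ∪ B₁) (B₂ ∩ A₁) ≡ 2 →
            SeparatesMajorities A₁ B₁ W₁ W₂ ⊎ SeparatesMajorities A₂ B₂ W₁ W₂ →
            Conclusion G xs A₁ B₁ A₂ B₂ W₁ W₂
    tight _ _ (inj₁ (inj₁ (A₁⊇W₁ , _))) = ⊥-elim (¬majority-on-both-sides W₁ S₁ (≤-reflexive o₁) A₁⊇W₁ maj₁)
    tight _ T₂≡2 (inj₁ (inj₂ (_ , A₁⊇W₂))) =
      inj₂ (A₁ , B₁ , A₂ ∪ B₁ , B₂ ∩ A₁ , S₁ , o₁ , T₂ , T₂≡2 , xs⊆A₁ , All.map ∈-∪ˡ xs⊆A₂ , maj₁ ,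
            majority-in-crossing W₂ S₁ (≤-reflexive o₁) S₂ (≤-reflexive o₂) T₂ (≤-reflexive T₂≡2) A₁⊇W₂ maj₂ , ─∩∩─-empty B₁ B₂ (A₂ ∪ B₁) A₁ , inj₁ refl)
    tight T₁≡2 _ (inj₂ (inj₁ (A₂⊇W₁ , _))) =
      inj₂ (A₁ ∪ B₂ , B₁ ∩ A₂ , A₂ , B₂ , T₁ , T₁≡2 , S₂ , o₂ , All.map ∈-∪ˡ xs⊆A₁ , xs⊆A₂ ,
            majority-in-crossing W₁ S₂ (≤-reflexive o₂) S₁ (≤-reflexive o₁) T₁ (≤-reflexive T₁≡2) A₂⊇W₁ maj₁ , maj₂ , ∩─∩─-empty B₂ B₁ (A₁ ∪ B₂) A₂ , inj₂ refl)
    tight _ _ (inj₂ (inj₂ (_ , A₂⊇W₂))) = ⊥-elim (¬majority-on-both-sides W₂ S₂ (≤-reflexive o₂) A₂⊇W₂ maj₂)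
    by-orders : Dec (order {G} (A₁ ∪ B₂) (B₁ ∩ A₂) ≤ 1) → Dec (order {G} (A₂ ∪ B₁) (B₂ ∩ A₁) ≤ 1) →
                Conclusion G xs A₁ B₁ A₂ B₂ W₁ W₂
    by-orders (yes T₁≤1) _ =
      inj₁ (A₂ , B₂ , S₂ , o₂ , xs⊆A₂ , ─∪─⊆ʳ (∩⊆∪⇒─⊆ (proj₁ S₂) (small T₁ T₁≤1 (All.map ∈-∪ˡ xs⊆A₁))))
    by-orders (no _) (yes T₂≤1) =
      inj₁ (A₁ , B₁ , S₁ , o₁ , xs⊆A₁ , ─∪─⊆ˡ (∩⊆∪⇒─⊆ (proj₁ S₁) (small T₂ T₂≤1 (All.map ∈-∪ˡ xs⊆A₂))))
    by-orders (no T₁≰1) (no T₂≰1) =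
      tight (m+n≤4⇒n≡2 (subst (_≤ 4) (+-comm (order {G} (A₁ ∪ B₂) (B₁ ∩ A₂)) _) sum) T₂≰1 T₁≰1) (m+n≤4⇒n≡2 sum T₁≰1 T₂≰1) separated

lemma5p3 : (G : Digraph) (s t : List (V G)) →
    (∀ A B → IsSeparation G A B → order {G} A B ≡ 1 → AllIn {G} (s ++ t) A →
       ∃[ v ] (v ∈ B × v ∉ A) → ⊥) →
    (A₁ B₁ A₂ B₂ : VSet G) →
    IsSeparation G A₁ B₁ → order {G} A₁ B₁ ≡ 2 →
    IsSeparation G A₂ B₂ → order {G} A₂ B₂ ≡ 2 →
    (m₁ m₂ : ℕ) → 2 ≤ m₁ → 2 ≤ m₂ →
    (W₁ : CylWall G m₁) (W₂ : CylWall G m₂) →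
    AllIn {G} (s ++ t) (A₁ ∩ A₂) →
    ContainsMajority B₁ W₁ → ContainsMajority B₂ W₂ →
    (SeparatesMajorities A₁ B₁ W₁ W₂ ⊎ SeparatesMajorities A₂ B₂ W₁ W₂) →
    (∃[ A ] ∃[ B ] (IsSeparation G A B × order {G} A B ≡ 2 ×
        AllIn {G} (s ++ t) A × ((B₁ ─ A₁) ∪ (B₂ ─ A₂)) ⊆ B))
    ⊎
    (∃[ A₁' ] ∃[ B₁' ] ∃[ A₂' ] ∃[ B₂' ]
       (IsSeparation G A₁' B₁' × order {G} A₁' B₁' ≡ 2 ×
        IsSeparation G A₂' B₂' × order {G} A₂' B₂' ≡ 2 ×
        AllIn {G} (s ++ t) A₁' × AllIn {G} (s ++ t) A₂' ×
        ContainsMajority B₁' W₁ × ContainsMajority B₂' W₂ ×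
        Empty ((B₁' ─ A₁') ∩ (B₂' ─ A₂')) ×
        (((A₁' , B₁') ≡ (A₁ , B₁)) ⊎ ((A₂' , B₂') ≡ (A₂ , B₂)))))
lemma5p3 G s t noCut A₁ B₁ A₂ B₂ S₁ o₁ S₂ o₂ _ _ (s≤s (s≤s z≤n)) (s≤s (s≤s z≤n)) W₁ W₂ xs⊆ maj₁ maj₂ separated
  with aligned-or-opposed S₁ S₂
... | inj₁ aligned = uncross-aligned noCut u₀≢u₁ S₁ o₁ S₂ o₂ xs⊆ aligned W₁ W₂ maj₁ maj₂
  where open WallFacts W₁ using () renaming (distinct-vertices to u₀≢u₁)
... | inj₂ opposed = uncross-opposed noCut u₀≢u₁ S₁ o₁ S₂ o₂ xs⊆ opposed W₁ W₂ maj₁ maj₂ separated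
  where open WallFacts W₁ using () renaming (distinct-vertices to u₀≢u₁)
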